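{- Assume the setting of the context, with integers $0\le d<e\le\lambda_1$, and let $(S,T)\in\boldsymbol{S}_{(d,e)}$. Then the set $U_M=\{B_0,B_1,\ldots,B_M\}$ associated to a spanning tree $\{(B_k,C_k)\}_{1\le k\le M}$ for $(S,T)$ is independent of the choice of spanning tree.
   Context: Fix integers $N \ge n\ge 1$ and partitions $\rho=(\rho_1,\ldots,\rho_n)$, $\lambda=(\lambda_1,\ldots,\lambda_n)$ (weakly decreasing nonnegative integers) such that there is exactly one $r$ with $\lambda_r=\rho_r-1$ and $\lambda_i=\rho_i$ for $i\ne r$. Position $(i,j)$ means row $i$, column $j$. For an integer $d$, $\rho/d$ is the skew shape obtained from the Young diagram of $\rho$ by removing the first $d$ boxes of the first row (similarly $\lambda/e$). A skew SSYT is a filling of a skew shape with positive integers satisfying the "skew SSYT requirements": entries weakly increase along rows and strictly increase down columns. $\boldsymbol{S}_{(d,e)}$ is the set of pairs $(S,T)$ with $S$ a skew SSYT of shape $\rho/d$ and $T$ a skew SSYT of shape $\lambda/e$, both with entries in $\{1,\ldots,N-1\}$; $S_{i,j}$ denotes an entry. For $(S,T)\in\boldsymbol{S}_{(d,e)}$ use the convention $T_{1,j}=0$ for $d<j\le e$, and a box with entry $0$ is regarded as missing. For a set $U$ of positions in $\rho/d$ containing $(r,\rho_r)$, $S'_U$ is obtained from $T$ by adding a box at $(r,\rho_r)$ with entry $S_{r,\rho_r}$ and replacing $T_{i,j}$ by $S_{i,j}$ for each $(i,j)\in U\setminus\{(r,\rho_r)\}$; $T'_U$ is obtained from $S$ by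 removing the box at $(r,\rho_r)$ and replacing $S_{i,j}$ by $T_{i,j}$ for each $(i,j)\in U\setminus\{(r,\rho_r)\}$. A sequence $\{(B_k,C_k)\}_{1\le k\le M}$ ($M\ge 0$) of pairs of positions in $\rho/d$ is a spanning tree for $(S,T)$ if, with $B_0=(r,\rho_r)$ and $U_K=\{B_0,\ldots,B_K\}$: (1) $B_k\in\rho/d\setminus U_{k-1}$ and $C_k\in U_{k-1}$ for each $k$; (2) $B_k$ and $C_k$ are adjacent ($C_k=B_k\pm(1,0)$ or $B_k\pm(0,1)$); (3) for each $k$, $S'_{U_{k-1}}$ and $T'_{U_{k-1}}$ are not both skew SSYT's, and $(B_k,C_k)$ is a pair of adjacent positions at which one or both of them fail the skew SSYT requirements; (4) it is maximal: there is no pair $(B_{M+1},C_{M+1})$ of adjacent positions at which $S'_{U_M}$ or $T'_{U_M}$ fails the skew SSYT requirements. -}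

module Defs where

open import Data.Nat using (ℕ; zero; suc; _≤_; _<_; _∸_; _≡ᵇ_; _<ᵇ_; _≤ᵇ_)
import Data.Nat as Nat
open import Data.Bool using (Bool; true; false; if_then_else_; _∧_)
open import Data.Product using (_×_; _,_)
import Data.Product.Properties as ×P
open import Data.Sum using (_⊎_)
open import Data.Vec using (Vec; []; _∷_)
open import Data.List using (List; []; _∷_)
open import Data.List.Membership.Propositional using (_∈_; _∉_)
import Data.List.Membership.DecPropositional as DecMem
open import Relation.Nullary using (¬_; does)
open import Relation.Binary.PropositionalEquality using (_≡_; _≢_)
open import Relation.Binary.Definitions using (DecidableEquality)

-- Positions (i , j) = (row , column), both 1-indexed.
Pos : Set
Pos = ℕ × ℕ

_≟ₚ_ : DecidableEquality Pos
_≟ₚ_ = ×P.≡-dec Nat._≟_ Nat._≟_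

open DecMem _≟ₚ_ using (_∈?_)

row : ∀ {n} → Vec ℕ n → ℕ → ℕ
row v zero = 0
row [] (suc i) = 0
row (x ∷ v) (suc zero) = x
row (x ∷ v) (suc (suc i)) = row v (suc i)

IsPartition : ∀ {n} → Vec ℕ n → Set
IsPartition {n} σ = ∀ i → 1 ≤ i → i < n → row σ (suc i) ≤ row σ i

-- (i , j) is a box of the skew shape σ/d (σ with the first d boxes of row 1 removed).
InSkew : ∀ {n} → Vec ℕ n → ℕ → Pos → Set
InSkew {n} σ d (i , j) = 1 ≤ i × i ≤ n × 1 ≤ j × j ≤ row σ i × (i ≡ 1 → d < j)

Adjacent : Pos → Pos → Set
Adjacent (i , j) (i' , j') =
  (i ≡ i' × (suc j ≡ j' ⊎ suc j' ≡ j)) ⊎ (j ≡ j' × (suc i ≡ i' ⊎ suc i' ≡ i))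

FailOrd : (Pos → ℕ) → (Pos → Set) → Pos → Pos → Set
FailOrd F D (i , j) q =
    (q ≡ (i , suc j) × D (i , j) × D q × F q < F (i , j))
  ⊎ (q ≡ (suc i , j) × D (i , j) × D q × F q ≤ F (i , j))

FailsAt : (Pos → ℕ) → (Pos → Set) → Pos → Pos → Set
FailsAt F D p q = FailOrd F D p q ⊎ FailOrd F D q p

-- F satisfies the skew SSYT requirements on the domain D
-- (entries 0 stand for missing boxes).
Good : (Pos → ℕ) → (Pos → Set) → Set
Good F D = ∀ p q → ¬ FailOrd F D p q

SkewSSYT : ∀ {n} → ℕ → Vec ℕ n → ℕ → (Pos → ℕ) → Set
SkewSSYT N σ d F =
  (∀ p → InSkew σ d p → 1 ≤ F p × F p ≤ N ∸ 1) × Good F (InSkew σ d)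

Text : (Pos → ℕ) → ℕ → ℕ → Pos → ℕ
Text T d e (i , j) = if (i ≡ᵇ 1) ∧ (d <ᵇ j) ∧ (j ≤ᵇ e) then 0 else T (i , j)

-- S'_U : T with S-entries on U (U contains B₀, where the entry is S_{B₀}).
S' : (S T : Pos → ℕ) → ℕ → ℕ → List Pos → Pos → ℕ
S' S T d e U p = if does (p ∈? U) then S p else Text T d e p

-- T'_U : S with T-entries on U ∖ {B₀} (box B₀ removed via the domain).
T' : (S T : Pos → ℕ) → ℕ → ℕ → List Pos → Pos → ℕ
T' S T d e U p = if does (p ∈? U) then Text T d e p else S p

DomS : ∀ {n} → Vec ℕ n → ℕ → Pos → Set
DomS ρ d = InSkew ρ d

DomT : ∀ {n} → Vec ℕ n → ℕ → Pos → Pos → Set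
DomT ρ d B₀ p = InSkew ρ d p × p ≢ B₀

module Tree {n : ℕ} (ρ : Vec ℕ n) (d e : ℕ) (S T : Pos → ℕ) (B₀ : Pos) where

  SU TU : List Pos → Pos → ℕ
  SU U = S' S T d e U
  TU U = T' S T d e U

  Fails : List Pos → Pos → Pos → Set
  Fails U B C = FailsAt (SU U) (DomS ρ d) B C ⊎ FailsAt (TU U) (DomT ρ d B₀) B C

  -- condition (4): no further pair (B,C) satisfying (1)–(3)
  Maximal : List Pos → Set
  Maximal U = ∀ B C → InSkew ρ d B → B ∉ U → C ∈ U → Adjacent B C → ¬ Fails U B C

  data IsTreeFrom : List Pos → List (Pos × Pos) → Set where
    done : ∀ {U} → Maximal U → IsTreeFrom U []
    step : ∀ {U B C τ} →
      InSkew ρ d B → B ∉ U → C ∈ U →                         -- (1)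
      Adjacent B C →                                           -- (2)
      ¬ (Good (SU U) (DomS ρ d) × Good (TU U) (DomT ρ d B₀)) → -- (3)
      Fails U B C →                                            -- (3)
      IsTreeFrom (B ∷ U) τ → IsTreeFrom U ((B , C) ∷ τ)

  IsSpanningTree : List (Pos × Pos) → Set
  IsSpanningTree τ = IsTreeFrom (B₀ ∷ []) τ

finalU : List Pos → List (Pos × Pos) → List Pos
finalU U [] = U
finalU U ((B , C) ∷ τ) = finalU (B ∷ U) τ

{-# OPTIONS --safe #-}
-- A set U is closed (Tree.Maximal) when no B ∉ U adjacent to some C ∈ U makes
-- S'_U or T'_U fail at (B, C). Whether they fail at (B, C) depends only on the
-- entries of S'_U and T'_U at B and C, i.e. only on B ∉ U and C ∈ U. Hence, by
-- induction along a spanning tree, every B_k lies in every closed set containing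
-- B₀; as U_M is itself closed, it is the least closed set containing B₀.
module Submission where

open import Defs
open import Data.Nat using (ℕ; suc; _≤_; _<_)
open import Data.Vec using (Vec)
open import Data.Product using (_×_; _,_)
open import Data.Sum using (inj₁; inj₂)
import Data.Sum as Sum
open import Data.Bool using (if_then_else_)
open import Data.Empty using (⊥-elim)
open import Data.List using (List; []; [_]; _∷_)
open import Data.List.Relation.Unary.Any using (here; there)
open import Data.List.Membership.Propositional using (_∈_; _∉_)
import Data.List.Membership.DecPropositional as DecMem
open import Data.List.Relation.Binary.Subset.Propositional using (_⊆_)
open import Relation.Nullary using (does; yes; no)
open import Relation.Nullary.Decidable using (dec-true; dec-false)
open import Relation.Binary.PropositionalEquality
  using (_≡_; _≢_; refl; subst₂)

open DecMem _≟ₚ_ using (_∈?_)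

FailOrd-resp : ∀ {F G : Pos → ℕ} {D : Pos → Set} {p q} →
  F p ≡ G p → F q ≡ G q → FailOrd F D p q → FailOrd G D p q
FailOrd-resp Fp≡Gp Fq≡Gq (inj₁ (refl , Dp , Dq , lt)) = inj₁ (refl , Dp , Dq , subst₂ _<_ Fq≡Gq Fp≡Gp lt)
FailOrd-resp Fp≡Gp Fq≡Gq (inj₂ (refl , Dp , Dq , le)) = inj₂ (refl , Dp , Dq , subst₂ _≤_ Fq≡Gq Fp≡Gp le)

FailsAt-resp : ∀ {F G : Pos → ℕ} {D : Pos → Set} {p q} →
  F p ≡ G p → F q ≡ G q → FailsAt F D p q → FailsAt G D p q
FailsAt-resp Fp≡Gp Fq≡Gq = Sum.map (FailOrd-resp Fp≡Gp Fq≡Gq) (FailOrd-resp Fq≡Gq Fp≡Gp)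

module _ {a} {A : Set a} (x y : A) where

  if-∈-cong : ∀ {p U V} → p ∈ U → p ∈ V →
    (if does (p ∈? U) then x else y) ≡ (if does (p ∈? V) then x else y)
  if-∈-cong {p} {U} {V} p∈U p∈V
    rewrite dec-true (p ∈? U) p∈U | dec-true (p ∈? V) p∈V = refl

  if-∉-cong : ∀ {p U V} → p ∉ U → p ∉ V →
    (if does (p ∈? U) then x else y) ≡ (if does (p ∈? V) then x else y)
  if-∉-cong {p} {U} {V} p∉U p∉V
    rewrite dec-false (p ∈? U) p∉U | dec-false (p ∈? V) p∉V = refl

⊆-finalU : ∀ U τ → U ⊆ finalU U τ
⊆-finalU U []            = λ x∈U → x∈U
⊆-finalU U ((B , _) ∷ τ) = λ x∈U → ⊆-finalU (B ∷ U) τ (there x∈U)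

module _ {n : ℕ} (ρ : Vec ℕ n) (d e : ℕ) (S T : Pos → ℕ) (B₀ : Pos) where
  open Tree ρ d e S T B₀

  Fails-transport : ∀ {U V B C} → B ∉ U → B ∉ V → C ∈ U → C ∈ V → Fails U B C → Fails V B C
  Fails-transport B∉U B∉V C∈U C∈V = Sum.map
    (FailsAt-resp (if-∉-cong _ _ B∉U B∉V) (if-∈-cong _ _ C∈U C∈V))
    (FailsAt-resp (if-∉-cong _ _ B∉U B∉V) (if-∈-cong _ _ C∈U C∈V))

  finalU-maximal : ∀ {U τ} → IsTreeFrom U τ → Maximal (finalU U τ)
  finalU-maximal (done max)             = max
  finalU-maximal (step _ _ _ _ _ _ tree) = finalU-maximal tree

  finalU-⊆-maximal : ∀ {U V τ} → IsTreeFrom U τ → U ⊆ V → Maximal V → finalU U τ ⊆ V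
  finalU-⊆-maximal (done _) U⊆V _ = U⊆V
  finalU-⊆-maximal {U} {V} (step {B = B} {C} B∈ρ/d B∉U C∈U adj _ fails tree) U⊆V maxV =
    finalU-⊆-maximal tree B∷U⊆V maxV
    where
    B∈V : B ∈ V
    B∈V with B ∈? V
    ... | yes B∈V = B∈V
    ... | no  B∉V = ⊥-elim (maxV B C B∈ρ/d B∉V (U⊆V C∈U) adj
                              (Fails-transport B∉U B∉V C∈U (U⊆V C∈U) fails))

    B∷U⊆V : B ∷ U ⊆ V
    B∷U⊆V (here refl) = B∈V
    B∷U⊆V (there x∈U) = U⊆V x∈U

  finalU-unique : ∀ {U τ₁ τ₂} → IsTreeFrom U τ₁ → IsTreeFrom U τ₂ →
    finalU U τ₁ ⊆ finalU U τ₂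
  finalU-unique {U} {τ₂ = τ₂} tree₁ tree₂ =
    finalU-⊆-maximal tree₁ (⊆-finalU U τ₂) (finalU-maximal tree₂)

-- Only conditions (1), (2) and (4) on the trees are used; the shape and tableau hypotheses are not.
lemma2p7 : (N n : ℕ) → 1 ≤ n → n ≤ N →
    (ρ lam : Vec ℕ n) → IsPartition ρ → IsPartition lam →
    (r : ℕ) → 1 ≤ r → r ≤ n → suc (row lam r) ≡ row ρ r →
    (∀ i → 1 ≤ i → i ≤ n → i ≢ r → row lam i ≡ row ρ i) →
    (d e : ℕ) → d < e → e ≤ row lam 1 →
    (S T : Pos → ℕ) → SkewSSYT N ρ d S → SkewSSYT N lam e T →
    (τ₁ τ₂ : List (Pos × Pos)) →
    Tree.IsSpanningTree ρ d e S T (r , row ρ r) τ₁ →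
    Tree.IsSpanningTree ρ d e S T (r , row ρ r) τ₂ →
    finalU [ (r , row ρ r) ] τ₁ ⊆ finalU [ (r , row ρ r) ] τ₂
      × finalU [ (r , row ρ r) ] τ₂ ⊆ finalU [ (r , row ρ r) ] τ₁
lemma2p7 N n _ _ ρ lam _ _ r _ _ _ _ d e _ _ S T _ _ τ₁ τ₂ tree₁ tree₂ =
    finalU-unique ρ d e S T (r , row ρ r) tree₁ tree₂
  , finalU-unique ρ d e S T (r , row ρ r) tree₂ tree₁
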